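{- Let $G$ be a finite simple graph without isolated vertices, let $\varphi=\varphi(G)$, and let $U \subseteq V(G)$. Then $|\mathbf{BF}_{\varphi}(U)|=|\mathbf{TRACES}_G(U)|$.
   Context: For a graph $G$ without isolated vertices, $\varphi(G)$ is the monotone 2-CNF whose variables are the vertices of $G$ and whose clauses are $(u \vee v)$ for each edge $\{u,v\}\in E(G)$. An assignment to a set of variables is a consistent set of literals over those variables; an assignment $S$ satisfies a clause $C$ if $S\cap C\neq\emptyset$, and satisfies a CNF if it satisfies every clause. For an assignment $S$, $\varphi|_S$ is obtained from $\varphi$ by removing all clauses satisfied by $S$ and removing the occurrences of variables of $S$ from the remaining clauses. For $U\subseteq Var(\varphi)$, $\mathbf{A}_\varphi(U)$ is the set of all assignments to $U$ that can be extended to a satisfying assignment of $\varphi$, and $\mathbf{BF}_\varphi(U)$ is the set of Boolean functions (on the variables $Var(\varphi)\setminus U$) represented by $\varphi|_A$ for $A\in \mathbf{A}_\varphi(U)$. For $S\subseteq V(G)$, $N(S)$ denotes the set of vertices not in $S$ that are adjacent to some vertex of $S$. For $U\subseteq V(G)$, $\mathbf{ISET}_G(U)$ is the family of all independent subsets of $U$ (including $\emptyset$), and with $V=V(G)\setminus U$, $\mathbf{TRACES}_G(U)=\{N(S)\cap V : S\in \mathbf{ISET}_G(U)\}$. -}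

module Defs where

open import Data.Nat using (ℕ; zero; suc)
open import Data.Bool using (Bool; true; false; _∧_; _∨_; not; if_then_else_)
import Data.Bool.Properties as BoolP
open import Data.Fin using (Fin)
open import Data.Vec using (Vec; []; _∷_; lookup; tabulate)
import Data.Vec.Properties as VecP
open import Data.List using (List; []; _∷_; [_]; map; _++_; filterᵇ; deduplicate; length; allFin; concatMap)
open import Data.Bool.ListAction using (all; any)
import Data.List.Properties as ListP
open import Data.Product using (_×_; _,_; ∃)
open import Relation.Binary.PropositionalEquality using (_≡_)

Graph : ℕ → Set
Graph n = Fin n → Fin n → Bool

IsSimple : ∀ {n} → Graph n → Set
IsSimple {n} G = (∀ (v : Fin n) → G v v ≡ false) × (∀ (u v : Fin n) → G u v ≡ G v u)

NoIsolated : ∀ {n} → Graph n → Set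
NoIsolated {n} G = ∀ (v : Fin n) → ∃ λ (u : Fin n) → G v u ≡ true

-- Subsets of the vertex set (characteristic vectors); also total truth assignments
-- (the set of variables set to true).
VSet : ℕ → Set
VSet n = Vec Bool n

allVSets : ∀ n → List (VSet n)
allVSets zero = [ [] ]
allVSets (suc n) = map (true ∷_) (allVSets n) ++ map (false ∷_) (allVSets n)

_⊆ᵇ_ : ∀ {n} → VSet n → VSet n → Bool
_⊆ᵇ_ {n} A B = all (λ i → not (lookup A i) ∨ lookup B i) (allFin n)

-- The monotone 2-CNF φ(G): one clause (u ∨ v) for each edge {u,v}
-- (each edge listed in both orientations, which does not change the formula).
Clause : ℕ → Set
Clause n = Fin n × Fin n

φ : ∀ {n} → Graph n → List (Clause n)
φ {n} G = concatMap (λ u → map (u ,_) (filterᵇ (G u) (allFin n))) (allFin n)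

evalCNF : ∀ {n} → List (Clause n) → VSet n → Bool
evalCNF cs τ = all (λ { (u , v) → lookup τ u ∨ lookup τ v }) cs

-- An assignment to U is represented by A ⊆ U (variables of U in A are true,
-- those in U ∖ A are false).  combine U A β is the total assignment agreeing
-- with A on U and with β on V = V(G) ∖ U.
combine : ∀ {n} → VSet n → VSet n → VSet n → VSet n
combine U A β = tabulate λ i → if lookup U i then lookup A i else lookup β i

extendable : ∀ {n} → List (Clause n) → VSet n → VSet n → Bool
extendable {n} cs U A = any (λ β → evalCNF cs (combine U A β)) (allVSets n)

assignmentsTo : ∀ {n} → VSet n → List (VSet n)
assignmentsTo {n} U = filterᵇ (λ A → A ⊆ᵇ U) (allVSets n)

Aφ : ∀ {n} → List (Clause n) → VSet n → List (VSet n)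
Aφ cs U = filterᵇ (extendable cs U) (assignmentsTo U)

-- The Boolean function (on the variables V = V(G) ∖ U) represented by φ|_A,
-- given by its truth table: its value on an assignment β to V is the value of φ
-- under A ∪ β.  (Inputs β range over all total assignments; their values on U are
-- ignored, so two restrictions are the same Boolean function iff their tables agree.)
truthTable : ∀ {n} → List (Clause n) → VSet n → VSet n → List Bool
truthTable {n} cs U A = map (λ β → evalCNF cs (combine U A β)) (allVSets n)

BF : ∀ {n} → List (Clause n) → VSet n → List (List Bool)
BF cs U = deduplicate (ListP.≡-dec BoolP._≟_) (map (truthTable cs U) (Aφ cs U))

independentᵇ : ∀ {n} → Graph n → VSet n → Bool
independentᵇ {n} G S =
  all (λ u → all (λ v → not (lookup S u ∧ lookup S v ∧ G u v)) (allFin n)) (allFin n)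

ISET : ∀ {n} → Graph n → VSet n → List (VSet n)
ISET G U = filterᵇ (λ S → (S ⊆ᵇ U) ∧ independentᵇ G S) (allVSets _)

Nbhd : ∀ {n} → Graph n → VSet n → VSet n
Nbhd {n} G S = tabulate λ v → not (lookup S v) ∧ any (λ s → lookup S s ∧ G s v) (allFin n)

_∩compl_ : ∀ {n} → VSet n → VSet n → VSet n
X ∩compl U = tabulate λ v → lookup X v ∧ not (lookup U v)

TRACES : ∀ {n} → Graph n → VSet n → List (VSet n)
TRACES G U = deduplicate (VecP.≡-dec BoolP._≟_) (map (λ S → Nbhd G S ∩compl U) (ISET G U))

-- An assignment to U is a set A ⊆ U of variables set to true; write F = U ∖ A for the
-- variables it sets to false.  Satisfying assignments of φ(G) are the vertex covers of G,
-- and setting A on U and β elsewhere makes exactly (U ∪ β) ∖ F true.  This is a cover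
-- iff F is independent, U ∪ β is a cover, and β contains the trace N(F) ∖ U.  Hence
-- A ∈ A_φ(U) iff F is independent, and φ|_A is the function
-- β ↦ (N(F) ∖ U ⊆ β) ∧ φ(U := true, β), which depends on A only through the trace.
-- Conversely the trace can be read off this function: evaluated at the assignment
-- making everything but v true (which satisfies φ(U := true) as G has no loops) it
-- returns whether v lies outside the trace.  So A ↦ φ|_A and S ↦ N(S) ∖ U induce a
-- bijection between BF_φ(U) and TRACES_G(U).
module Submission where

open import Defs
open import Data.Nat using (ℕ; suc)
open import Data.Bool using (Bool; true; false; _∧_; _∨_; not; if_then_else_; T; T?)
open import Data.Bool.Properties using (T-∧; T-∨; not-involutive; not-injective; ∧-identityʳ)
import Data.Bool.Properties as Bool
open import Data.Bool.ListAction using (all; any)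
open import Data.Empty using (⊥-elim)
open import Data.Fin using (Fin)
open import Data.Fin.Properties using (_≟_)
open import Data.Vec using ([]; _∷_; lookup; tabulate; replicate)
open import Data.Vec.Properties using (lookup∘tabulate; tabulate-cong; lookup-replicate)
import Data.Vec.Properties as Vec
open import Data.Vec.Relation.Binary.Pointwise.Extensional using (ext; Pointwise-≡⇒≡)
open import Data.List using (List; []; _∷_; map; filterᵇ; deduplicate; length; allFin)
open import Data.List.Properties using (∷-injective; map-cong; length-map)
import Data.List.Properties as List
open import Data.List.Membership.Propositional using (_∈_; find; lose)
open import Data.List.Membership.Propositional.Properties
  using (∈-map⁺; ∈-map⁻; ∈-concatMap⁺; ∈-concatMap⁻; ∈-++⁺ˡ; ∈-++⁺ʳ; ∈-filter⁺; ∈-filter⁻;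
         ∈-allFin; ∈-deduplicate⁺; ∈-deduplicate⁻)
open import Data.List.Membership.Propositional.Properties.WithK using (unique∧set⇒bag)
open import Data.List.Relation.Unary.Any using (here; there)
open import Data.List.Relation.Unary.Unique.Propositional using (Unique)
open import Data.List.Relation.Unary.Unique.Propositional.Properties using (map⁺)
open import Data.List.Relation.Unary.Unique.DecPropositional.Properties using (deduplicate-!)
open import Data.List.Relation.Binary.BagAndSetEquality using (∼bag⇒↭)
open import Data.List.Relation.Binary.Permutation.Propositional.Properties using (↭-length)
open import Data.Product using (_×_; _,_; ∃; proj₁; proj₂)
open import Data.Product.Function.NonDependent.Propositional using (_×-⇔_)
open import Data.Sum using (_⊎_; inj₁; inj₂)
import Data.Sum as Sum
open import Function using (_∘_)
open import Function.Bundles using (_⇔_; mk⇔; Equivalence)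
import Function.Properties.Equivalence as ⇔
open import Function.Related.Propositional using (module EquationalReasoning)
open import Function.Related.TypeIsomorphisms using (×-comm)
open import Relation.Nullary using (¬_; yes; no)
open import Relation.Nullary.Decidable using (isYes; toWitness; fromWitness)
open import Relation.Binary.Definitions using (DecidableEquality)
open import Relation.Binary.PropositionalEquality
  using (_≡_; _≢_; refl; sym; trans; cong; cong₂; subst; module ≡-Reasoning)

open Equivalence using (to; from)

T-not : ∀ x → T (not x) ⇔ (¬ T x)
T-not false = mk⇔ (λ _ ()) _
T-not true  = mk⇔ (λ ()) (λ ¬⊤ → ¬⊤ _)

T-not-∨ : ∀ x {y} → T (not x ∨ y) ⇔ (T x → T y)
T-not-∨ false = mk⇔ (λ _ ()) _
T-not-∨ true  = mk⇔ (λ y _ → y) (λ h → h _)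

T-not-∧₃ : ∀ x y z → T (not (x ∧ y ∧ z)) ⇔ (T x → T y → ¬ T z)
T-not-∧₃ false _     _ = mk⇔ (λ _ ()) _
T-not-∧₃ true  false _ = mk⇔ (λ _ _ ()) _
T-not-∧₃ true  true  z = mk⇔ (λ h _ _ → to (T-not z) h) (λ h → from (T-not z) (h _ _))

T-if-self : ∀ u {b} → T (if u then u else b) ⇔ (T u ⊎ T b)
T-if-self true  = mk⇔ inj₁ _
T-if-self false = mk⇔ inj₂ (λ { (inj₁ ()) ; (inj₂ b) → b })

if-then-else-∩compl : ∀ u a b → (if u then a else b) ≡ (if u then u else b) ∧ not (u ∧ not a)
if-then-else-∩compl true  a _ = sym (not-involutive a)
if-then-else-∩compl false _ b = sym (∧-identityʳ b)

T-⇔⇒≡ : ∀ {x y} → T x ⇔ T y → x ≡ y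
T-⇔⇒≡ {false} {false} _ = refl
T-⇔⇒≡ {false} {true}  h = ⊥-elim (from h _)
T-⇔⇒≡ {true}  {false} h = ⊥-elim (to h _)
T-⇔⇒≡ {true}  {true}  _ = refl

module _ {a} {C : Set a} (p : C → Bool) where

  T-all : ∀ xs → T (all p xs) ⇔ (∀ {x} → x ∈ xs → T (p x))
  T-all []       = mk⇔ (λ _ ()) _
  T-all (y ∷ ys) = mk⇔ sound complete
    where
    sound : T (all p (y ∷ ys)) → ∀ {x} → x ∈ y ∷ ys → T (p x)
    sound h (here refl) = proj₁ (to (T-∧ {p y}) h)
    sound h (there x∈)  = to (T-all ys) (proj₂ (to (T-∧ {p y}) h)) x∈
    complete : (∀ {x} → x ∈ y ∷ ys → T (p x)) → T (all p (y ∷ ys))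
    complete h = from (T-∧ {p y}) (h (here refl) , from (T-all ys) (h ∘ there))

  T-any : ∀ xs → T (any p xs) ⇔ (∃ λ x → x ∈ xs × T (p x))
  T-any []       = mk⇔ (λ ()) (λ { (_ , () , _) })
  T-any (y ∷ ys) = mk⇔ sound complete
    where
    sound : T (any p (y ∷ ys)) → ∃ λ x → x ∈ y ∷ ys × T (p x)
    sound h with to (T-∨ {p y}) h
    ... | inj₁ py = y , here refl , py
    ... | inj₂ h′ = let x , x∈ , px = to (T-any ys) h′ in x , there x∈ , px
    complete : (∃ λ x → x ∈ y ∷ ys × T (p x)) → T (any p (y ∷ ys))
    complete (x , here refl , px) = from (T-∨ {p y}) (inj₁ px)
    complete (x , there x∈ , px)  = from (T-∨ {p y}) (inj₂ (from (T-any ys) (x , x∈ , px)))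

  ∈-filterᵇ : ∀ {xs x} → x ∈ filterᵇ p xs ⇔ (x ∈ xs × T (p x))
  ∈-filterᵇ {xs} = mk⇔ (∈-filter⁻ (T? ∘ p) {xs = xs}) (λ (x∈ , px) → ∈-filter⁺ (T? ∘ p) x∈ px)

module _ {a b} {C : Set a} {D : Set b} (_≟ᴰ_ : DecidableEquality D) (f : C → D) where

  ∈-deduplicate-map : ∀ {xs y} → y ∈ deduplicate _≟ᴰ_ (map f xs) ⇔ (∃ λ x → x ∈ xs × y ≡ f x)
  ∈-deduplicate-map {xs} =
    mk⇔ (∈-map⁻ f ∘ ∈-deduplicate⁻ _≟ᴰ_ (map f xs))
        (λ { (x , x∈ , refl) → ∈-deduplicate⁺ _≟ᴰ_ (∈-map⁺ f x∈) })

map≡map⇒agree : ∀ {a b} {C : Set a} {D : Set b} {f g : C → D} {xs x} →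
                map f xs ≡ map g xs → x ∈ xs → f x ≡ g x
map≡map⇒agree {xs = _ ∷ _} eq (here refl) = proj₁ (∷-injective eq)
map≡map⇒agree {xs = _ ∷ _} eq (there x∈)  = map≡map⇒agree (proj₂ (∷-injective eq)) x∈

unique∧set⇒length≡ : ∀ {a} {C : Set a} {xs ys : List C} → Unique xs → Unique ys →
                     (∀ {z} → z ∈ xs ⇔ z ∈ ys) → length xs ≡ length ys
unique∧set⇒length≡ !xs !ys xs∼ys = ↭-length (∼bag⇒↭ (unique∧set⇒bag !xs !ys xs∼ys))

∈-allVSets : ∀ {n} (X : VSet n) → X ∈ allVSets n
∈-allVSets []                  = here refl
∈-allVSets {suc n} (true ∷ X)  = ∈-++⁺ˡ (∈-map⁺ (true ∷_) (∈-allVSets X))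
∈-allVSets {suc n} (false ∷ X) = ∈-++⁺ʳ (map (true ∷_) (allVSets n)) (∈-map⁺ (false ∷_) (∈-allVSets X))

infix 4 _∈ᵥ_ _⊆_

_∈ᵥ_ : ∀ {n} → Fin n → VSet n → Set
i ∈ᵥ X = T (lookup X i)

_⊆_ : ∀ {n} → VSet n → VSet n → Set
X ⊆ Y = ∀ {i} → i ∈ᵥ X → i ∈ᵥ Y

∈-tabulate : ∀ {n} (f : Fin n → Bool) {i} → i ∈ᵥ tabulate f ⇔ T (f i)
∈-tabulate f {i} = mk⇔ (subst T (lookup∘tabulate f i)) (subst T (sym (lookup∘tabulate f i)))

T-all-allFin : ∀ {n} (p : Fin n → Bool) → T (all p (allFin n)) ⇔ (∀ i → T (p i))
T-all-allFin {n} p = mk⇔ (λ h i → to (T-all p (allFin n)) h (∈-allFin i))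
                         (λ h → from (T-all p (allFin n)) (λ {i} _ → h i))

T-any-allFin : ∀ {n} (p : Fin n → Bool) → T (any p (allFin n)) ⇔ (∃ λ i → T (p i))
T-any-allFin {n} p = mk⇔ (λ h → let i , _ , pi = to (T-any p (allFin n)) h in i , pi)
                         (λ (i , pi) → from (T-any p (allFin n)) (i , ∈-allFin i , pi))

T-⊆ᵇ : ∀ {n} (X Y : VSet n) → T (X ⊆ᵇ Y) ⇔ X ⊆ Y
T-⊆ᵇ X Y = mk⇔ (λ h {i} → to (T-not-∨ (lookup X i)) (to (T-all-allFin included) h i))
               (λ h → from (T-all-allFin included) (λ i → from (T-not-∨ (lookup X i)) h))
  where
  included : Fin _ → Bool
  included i = not (lookup X i) ∨ lookup Y i

∈-∩compl : ∀ {n} (X Y : VSet n) {i} → i ∈ᵥ X ∩compl Y ⇔ (i ∈ᵥ X × ¬ i ∈ᵥ Y)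
∈-∩compl X Y {i} = mk⇔
  (λ h → let x , ¬y = to (T-∧ {lookup X i}) (to (∈-tabulate difference) h) in x , to (T-not _) ¬y)
  (λ (x , ¬y) → from (∈-tabulate difference) (from (T-∧ {lookup X i}) (x , from (T-not _) ¬y)))
  where
  difference : Fin _ → Bool
  difference j = lookup X j ∧ not (lookup Y j)

∩compl-⊆ : ∀ {n} (X Y : VSet n) → X ∩compl Y ⊆ X
∩compl-⊆ X Y = proj₁ ∘ to (∈-∩compl X Y)

∩compl-involutive : ∀ {n} (S U : VSet n) → S ⊆ U → U ∩compl (U ∩compl S) ≡ S
∩compl-involutive S U S⊆U = Pointwise-≡⇒≡ (ext λ i → T-⇔⇒≡ (mk⇔ sound (complete {i})))
  where
  sound : U ∩compl (U ∩compl S) ⊆ S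
  sound {i} i∈ with to (∈-∩compl U (U ∩compl S)) i∈ | T? (lookup S i)
  ... | _         , _      | yes i∈S = i∈S
  ... | i∈U , i∉U∖S | no  i∉S = ⊥-elim (i∉U∖S (from (∈-∩compl U S) (i∈U , i∉S)))
  complete : S ⊆ U ∩compl (U ∩compl S)
  complete i∈S = from (∈-∩compl U (U ∩compl S)) (S⊆U i∈S , λ i∈U∖S → proj₂ (to (∈-∩compl U S) i∈U∖S) i∈S)

module _ {n} (G : Graph n) where

  VertexCover : VSet n → Set
  VertexCover τ = ∀ {u v} → T (G u v) → u ∈ᵥ τ ⊎ v ∈ᵥ τ

  Independent : VSet n → Set
  Independent S = ∀ {u v} → u ∈ᵥ S → v ∈ᵥ S → ¬ T (G u v)

  ∈-φ : ∀ {u v} → (u , v) ∈ φ G ⇔ T (G u v)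
  ∈-φ {u} {v} = mk⇔ sound complete
    where
    edgesFrom : Fin n → List (Clause n)
    edgesFrom w = map (w ,_) (filterᵇ (G w) (allFin n))
    sound : (u , v) ∈ φ G → T (G u v)
    sound uv∈ with find (∈-concatMap⁻ edgesFrom {xs = allFin n} uv∈)
    ... | w , _ , uv∈w with ∈-map⁻ (w ,_) uv∈w
    ...   | _ , v∈ , refl = proj₂ (to (∈-filterᵇ (G u) {allFin n}) v∈)
    complete : T (G u v) → (u , v) ∈ φ G
    complete guv = ∈-concatMap⁺ edgesFrom
      (lose (∈-allFin u) (∈-map⁺ (u ,_) (from (∈-filterᵇ (G u)) (∈-allFin v , guv))))

  T-evalCNF-φ : ∀ τ → T (evalCNF (φ G) τ) ⇔ VertexCover τ
  T-evalCNF-φ τ =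
    mk⇔ (λ h {u} {v} guv → to (T-∨ {lookup τ u}) (to (T-all covered (φ G)) h (from ∈-φ guv)))
        (λ h → from (T-all covered (φ G)) (clauseCovered h))
    where
    covered : Clause n → Bool
    covered (u , v) = lookup τ u ∨ lookup τ v
    clauseCovered : VertexCover τ → ∀ {c} → c ∈ φ G → T (covered c)
    clauseCovered h {u , v} uv∈ = from (T-∨ {lookup τ u}) (h (to ∈-φ uv∈))

  T-independentᵇ : ∀ S → T (independentᵇ G S) ⇔ Independent S
  T-independentᵇ S = mk⇔
    (λ h {u} {v} → to (nonEdge⇔ u v) (to (T-all-allFin (nonEdge u)) (to (T-all-allFin noEdgeAt) h u) v))
    (λ h → from (T-all-allFin noEdgeAt) λ u → from (T-all-allFin (nonEdge u)) λ v → from (nonEdge⇔ u v) h)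
    where
    nonEdge : Fin n → Fin n → Bool
    nonEdge u v = not (lookup S u ∧ lookup S v ∧ G u v)
    noEdgeAt : Fin n → Bool
    noEdgeAt u = all (nonEdge u) (allFin n)
    nonEdge⇔ : ∀ u v → T (nonEdge u v) ⇔ (u ∈ᵥ S → v ∈ᵥ S → ¬ T (G u v))
    nonEdge⇔ u v = T-not-∧₃ (lookup S u) (lookup S v) (G u v)

  ∈-Nbhd : ∀ S {v} → v ∈ᵥ Nbhd G S ⇔ (¬ v ∈ᵥ S × ∃ λ s → s ∈ᵥ S × T (G s v))
  ∈-Nbhd S {v} = mk⇔ sound complete
    where
    adjacent : Fin n → Bool
    adjacent s = lookup S s ∧ G s v
    inNbhd : Fin n → Bool
    inNbhd w = not (lookup S w) ∧ any (λ s → lookup S s ∧ G s w) (allFin n)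
    sound : v ∈ᵥ Nbhd G S → ¬ v ∈ᵥ S × ∃ λ s → s ∈ᵥ S × T (G s v)
    sound h =
      let v∉S , adj = to (T-∧ {not (lookup S v)}) (to (∈-tabulate inNbhd) h)
          s , sv    = to (T-any-allFin adjacent) adj
      in to (T-not (lookup S v)) v∉S , s , to (T-∧ {lookup S s}) sv
    complete : ¬ v ∈ᵥ S × (∃ λ s → s ∈ᵥ S × T (G s v)) → v ∈ᵥ Nbhd G S
    complete (v∉S , s , s∈S , gsv) = from (∈-tabulate inNbhd) (from (T-∧ {not (lookup S v)})
      ( from (T-not (lookup S v)) v∉S
      , from (T-any-allFin adjacent) (s , from (T-∧ {lookup S s}) (s∈S , gsv))))

  ∈-ISET : ∀ U S → S ∈ ISET G U ⇔ (S ⊆ U × Independent S)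
  ∈-ISET U S = mk⇔ sound complete
    where
    member : VSet n → Bool
    member S = (S ⊆ᵇ U) ∧ independentᵇ G S
    sound : S ∈ ISET G U → S ⊆ U × Independent S
    sound S∈ =
      let S⊆U , independent = to (T-∧ {S ⊆ᵇ U}) (proj₂ (to (∈-filterᵇ member {allVSets n}) S∈))
      in to (T-⊆ᵇ S U) S⊆U , to (T-independentᵇ S) independent
    complete : S ⊆ U × Independent S → S ∈ ISET G U
    complete (S⊆U , independent) = from (∈-filterᵇ member)
      (∈-allVSets S , from (T-∧ {S ⊆ᵇ U}) (from (T-⊆ᵇ S U) S⊆U , from (T-independentᵇ S) independent))

  cover-∩compl⇒independent : ∀ σ F → VertexCover (σ ∩compl F) → Independent F
  cover-∩compl⇒independent σ F cover u∈F v∈F guv with cover guv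
  ... | inj₁ u∈ = proj₂ (to (∈-∩compl σ F) u∈) u∈F
  ... | inj₂ v∈ = proj₂ (to (∈-∩compl σ F) v∈) v∈F

cover-∩compl-independent : ∀ {n} {G : Graph n} → (∀ u v → G u v ≡ G v u) → ∀ σ F → Independent G F →
                           VertexCover G (σ ∩compl F) ⇔ (VertexCover G σ × Nbhd G F ⊆ σ)
cover-∩compl-independent {G = G} symmetric σ F independent = mk⇔ sound complete
  where
  sound : VertexCover G (σ ∩compl F) → VertexCover G σ × Nbhd G F ⊆ σ
  sound cover = Sum.map (∩compl-⊆ σ F) (∩compl-⊆ σ F) ∘ cover , neighbours
    where
    neighbours : Nbhd G F ⊆ σ
    neighbours v∈N with to (∈-Nbhd G F) v∈N
    ... | _ , s , s∈F , gsv with cover gsv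
    ...   | inj₁ s∈ = ⊥-elim (proj₂ (to (∈-∩compl σ F) s∈) s∈F)
    ...   | inj₂ v∈ = ∩compl-⊆ σ F v∈
  neighbour-covered : Nbhd G F ⊆ σ → ∀ {u v} → u ∈ᵥ F → T (G u v) → v ∈ᵥ σ ∩compl F
  neighbour-covered neighbours u∈F guv =
    from (∈-∩compl σ F) (neighbours (from (∈-Nbhd G F) (v∉F , _ , u∈F , guv)) , v∉F)
    where
    v∉F = λ v∈F → independent u∈F v∈F guv
  complete : VertexCover G σ × Nbhd G F ⊆ σ → VertexCover G (σ ∩compl F)
  complete (cover , neighbours) {u} {v} guv with T? (lookup F u) | T? (lookup F v)
  ... | yes u∈F | _       = inj₂ (neighbour-covered neighbours u∈F guv)
  ... | no  _   | yes v∈F = inj₁ (neighbour-covered neighbours v∈F (subst T (symmetric u v) guv))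
  ... | no  u∉F | no  v∉F = Sum.map (λ u∈σ → from (∈-∩compl σ F) (u∈σ , u∉F))
                                    (λ v∈σ → from (∈-∩compl σ F) (v∈σ , v∉F)) (cover guv)

module _ {n} (U : VSet n) where

  combine≡combine-self-∩compl : ∀ A β → combine U A β ≡ combine U U β ∩compl (U ∩compl A)
  combine≡combine-self-∩compl A β = tabulate-cong λ i → begin
    (if lookup U i then lookup A i else lookup β i)
      ≡⟨ if-then-else-∩compl (lookup U i) (lookup A i) (lookup β i) ⟩
    (if lookup U i then lookup U i else lookup β i) ∧ not (lookup U i ∧ not (lookup A i))
      ≡⟨ sym (cong₂ (λ x y → x ∧ not y) (lookup∘tabulate combineSelf i) (lookup∘tabulate difference i)) ⟩
    lookup (combine U U β) i ∧ not (lookup (U ∩compl A) i) ∎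
    where
    open ≡-Reasoning
    combineSelf difference : Fin n → Bool
    combineSelf j = if lookup U j then lookup U j else lookup β j
    difference j  = lookup U j ∧ not (lookup A j)

  ∈-combine-self : ∀ β {i} → i ∈ᵥ combine U U β ⇔ (i ∈ᵥ U ⊎ i ∈ᵥ β)
  ∈-combine-self β {i} =
    ⇔.trans (∈-tabulate (λ j → if lookup U j then lookup U j else lookup β j)) (T-if-self (lookup U i))

  ⊆-combine-self⇔∩compl-⊆ : ∀ X β → X ⊆ combine U U β ⇔ X ∩compl U ⊆ β
  ⊆-combine-self⇔∩compl-⊆ X β = mk⇔ sound complete
    where
    sound : X ⊆ combine U U β → X ∩compl U ⊆ β
    sound h i∈ with to (∈-∩compl X U) i∈
    ... | i∈X , i∉U with to (∈-combine-self β) (h i∈X)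
    ...   | inj₁ i∈U = ⊥-elim (i∉U i∈U)
    ...   | inj₂ i∈β = i∈β
    complete : X ∩compl U ⊆ β → X ⊆ combine U U β
    complete h {i} i∈X with T? (lookup U i)
    ... | yes i∈U = from (∈-combine-self β) (inj₁ i∈U)
    ... | no  i∉U = from (∈-combine-self β) (inj₂ (h (from (∈-∩compl X U) (i∈X , i∉U))))

module _ {n} {G : Graph n} (symmetric : ∀ u v → G u v ≡ G v u) (U : VSet n) where

  trace : VSet n → VSet n
  trace S = Nbhd G S ∩compl U

  traceFunction : VSet n → VSet n → Bool
  traceFunction R β = (R ⊆ᵇ β) ∧ evalCNF (φ G) (combine U U β)

  traceTable : VSet n → List Bool
  traceTable R = map (traceFunction R) (allVSets n)

  evalCNF-combine : ∀ A β → Independent G (U ∩compl A) →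
                    evalCNF (φ G) (combine U A β) ≡ traceFunction (trace (U ∩compl A)) β
  evalCNF-combine A β independent = T-⇔⇒≡ (begin
    T (evalCNF (φ G) (combine U A β))        ∼⟨ T-evalCNF-φ G (combine U A β) ⟩
    VertexCover G (combine U A β)            ≡⟨ cong (VertexCover G) (combine≡combine-self-∩compl U A β) ⟩
    VertexCover G (σ ∩compl F)               ∼⟨ cover-∩compl-independent symmetric σ F independent ⟩
    (VertexCover G σ × Nbhd G F ⊆ σ)         ∼⟨ ⇔.refl ×-⇔ ⊆-combine-self⇔∩compl-⊆ U (Nbhd G F) β ⟩
    (VertexCover G σ × trace F ⊆ β)          ↔⟨ ×-comm _ _ ⟩
    (trace F ⊆ β × VertexCover G σ)          ∼⟨ ⇔.sym (T-⊆ᵇ (trace F) β ×-⇔ T-evalCNF-φ G σ) ⟩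
    (T (trace F ⊆ᵇ β) × T (evalCNF (φ G) σ)) ∼⟨ ⇔.sym (T-∧ {trace F ⊆ᵇ β}) ⟩
    T (traceFunction (trace F) β)            ∎)
    where
    open EquationalReasoning
    σ = combine U U β
    F = U ∩compl A

  truthTable≡traceTable : ∀ A → Independent G (U ∩compl A) →
                          truthTable (φ G) U A ≡ traceTable (trace (U ∩compl A))
  truthTable≡traceTable A independent = map-cong (λ β → evalCNF-combine A β independent) (allVSets n)

  extendable⇔independent : ∀ A → T (extendable (φ G) U A) ⇔ Independent G (U ∩compl A)
  extendable⇔independent A = mk⇔ sound complete
    where
    satisfied : VSet n → Bool
    satisfied β = evalCNF (φ G) (combine U A β)
    sound : T (extendable (φ G) U A) → Independent G (U ∩compl A)
    sound h =
      let β , _ , sat = to (T-any satisfied (allVSets n)) h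
      in cover-∩compl⇒independent G (combine U U β) (U ∩compl A)
           (subst (VertexCover G) (combine≡combine-self-∩compl U A β)
                  (to (T-evalCNF-φ G (combine U A β)) sat))
    allTrue : VSet n
    allTrue = replicate n true
    everyVertex : ∀ {i} → i ∈ᵥ combine U U allTrue
    everyVertex {i} = from (∈-combine-self U allTrue) (inj₂ (subst T (sym (lookup-replicate i true)) _))
    complete : Independent G (U ∩compl A) → T (extendable (φ G) U A)
    complete independent =
      let cover = from (cover-∩compl-independent symmetric (combine U U allTrue) (U ∩compl A) independent)
                       ((λ _ → inj₁ everyVertex) , λ _ → everyVertex)
          sat = from (T-evalCNF-φ G (combine U A allTrue))
                     (subst (VertexCover G) (sym (combine≡combine-self-∩compl U A allTrue)) cover)
      in from (T-any satisfied (allVSets n)) (allTrue , ∈-allVSets allTrue , sat)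

  ∈-Aφ : ∀ A → A ∈ Aφ (φ G) U ⇔ (A ⊆ U × Independent G (U ∩compl A))
  ∈-Aφ A = mk⇔ sound complete
    where
    sound : A ∈ Aφ (φ G) U → A ⊆ U × Independent G (U ∩compl A)
    sound A∈ =
      let A∈assignments , extendsA = to (∈-filterᵇ (extendable (φ G) U) {assignmentsTo U}) A∈
      in  to (T-⊆ᵇ A U) (proj₂ (to (∈-filterᵇ (_⊆ᵇ U) {allVSets n}) A∈assignments))
        , to (extendable⇔independent A) extendsA
    complete : A ⊆ U × Independent G (U ∩compl A) → A ∈ Aφ (φ G) U
    complete (A⊆U , independent) = from (∈-filterᵇ (extendable (φ G) U))
      ( from (∈-filterᵇ (_⊆ᵇ U)) (∈-allVSets A , from (T-⊆ᵇ A U) A⊆U)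
      , from (extendable⇔independent A) independent)

  ∈-BF : ∀ {t} → t ∈ BF (φ G) U ⇔ t ∈ map traceTable (TRACES G U)
  ∈-BF = mk⇔ sound complete
    where
    decTable = List.≡-dec Bool._≟_
    decVSet  = Vec.≡-dec Bool._≟_
    sound : ∀ {t} → t ∈ BF (φ G) U → t ∈ map traceTable (TRACES G U)
    sound t∈ with to (∈-deduplicate-map decTable (truthTable (φ G) U)) t∈
    ... | A , A∈ , refl =
      let _ , independent = to (∈-Aφ A) A∈
          S∈ = from (∈-ISET G U (U ∩compl A)) (∩compl-⊆ U A , independent)
      in subst (_∈ map traceTable (TRACES G U)) (sym (truthTable≡traceTable A independent))
           (∈-map⁺ traceTable (from (∈-deduplicate-map decVSet trace) (_ , S∈ , refl)))
    complete : ∀ {t} → t ∈ map traceTable (TRACES G U) → t ∈ BF (φ G) U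
    complete t∈ with ∈-map⁻ traceTable t∈
    ... | R , R∈ , refl with to (∈-deduplicate-map decVSet trace) R∈
    ...   | S , S∈ , refl =
      let S⊆U , independent = to (∈-ISET G U S) S∈
          involution   = ∩compl-involutive S U S⊆U
          independent′ = subst (Independent G) (sym involution) independent
      in from (∈-deduplicate-map decTable (truthTable (φ G) U))
           ( U ∩compl S , from (∈-Aφ (U ∩compl S)) (∩compl-⊆ U S , independent′)
           , sym (trans (truthTable≡traceTable (U ∩compl S) independent′)
                        (cong (traceTable ∘ trace) involution)))

  module _ (irreflexive : ∀ v → G v v ≡ false) where

    allBut : Fin n → VSet n
    allBut v = tabulate λ i → not (isYes (i ≟ v))

    ∈-allBut : ∀ v {i} → i ∈ᵥ allBut v ⇔ (i ≢ v)
    ∈-allBut v {i} = ⇔.trans (∈-tabulate (λ j → not (isYes (j ≟ v))))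
      (⇔.trans (T-not (isYes (i ≟ v))) (mk⇔ (λ h i≡v → h (fromWitness i≡v)) (λ h t → h (toWitness t))))

    traceFunction-allBut : ∀ R v → traceFunction R (allBut v) ≡ not (lookup R v)
    traceFunction-allBut R v = T-⇔⇒≡ (mk⇔ sound complete)
      where
      inCombine : ∀ {i} → i ≢ v → i ∈ᵥ combine U U (allBut v)
      inCombine i≢v = from (∈-combine-self U (allBut v)) (inj₂ (from (∈-allBut v) i≢v))
      cover : VertexCover G (combine U U (allBut v))
      cover {u} {w} guw with u ≟ v
      ... | no  u≢v  = inj₁ (inCombine u≢v)
      ... | yes refl = inj₂ (inCombine λ { refl → subst T (irreflexive u) guw })
      sound : T (traceFunction R (allBut v)) → T (not (lookup R v))
      sound h = from (T-not (lookup R v))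
        (λ v∈R → to (∈-allBut v) (to (T-⊆ᵇ R (allBut v)) (proj₁ (to (T-∧ {R ⊆ᵇ allBut v}) h)) v∈R) refl)
      complete : T (not (lookup R v)) → T (traceFunction R (allBut v))
      complete v∉R = from (T-∧ {R ⊆ᵇ allBut v})
        ( from (T-⊆ᵇ R (allBut v)) (λ i∈R → from (∈-allBut v) λ { refl → to (T-not (lookup R v)) v∉R i∈R })
        , from (T-evalCNF-φ G (combine U U (allBut v))) cover)

    traceTable-injective : ∀ {R R′} → traceTable R ≡ traceTable R′ → R ≡ R′
    traceTable-injective {R} {R′} eq = Pointwise-≡⇒≡ (ext λ v → not-injective (begin
      not (lookup R v)             ≡⟨ sym (traceFunction-allBut R v) ⟩
      traceFunction R (allBut v)   ≡⟨ map≡map⇒agree eq (∈-allVSets (allBut v)) ⟩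
      traceFunction R′ (allBut v)  ≡⟨ traceFunction-allBut R′ v ⟩
      not (lookup R′ v)            ∎))
      where open ≡-Reasoning

lemma1 : (n : ℕ) (G : Graph n) → IsSimple G → NoIsolated G →
         (U : VSet n) → length (BF (φ G) U) ≡ length (TRACES G U)
lemma1 n G (irreflexive , symmetric) _ U = begin
  length (BF (φ G) U)
    ≡⟨ unique∧set⇒length≡ uniqueBF uniqueTables (∈-BF symmetric U) ⟩
  length (map (traceTable symmetric U) (TRACES G U))
    ≡⟨ length-map (traceTable symmetric U) (TRACES G U) ⟩
  length (TRACES G U) ∎
  where
  open ≡-Reasoning
  uniqueBF : Unique (BF (φ G) U)
  uniqueBF = deduplicate-! (List.≡-dec Bool._≟_) _
  uniqueTables : Unique (map (traceTable symmetric U) (TRACES G U))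
  uniqueTables = map⁺ (traceTable-injective symmetric U irreflexive) (deduplicate-! (Vec.≡-dec Bool._≟_) _)
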